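{- Let $\Phi=(A;\{E_i\}_{i=0}^d;A^*;\{E^*_i\}_{i=0}^d)$ be a pre Leonard system on $V$ with eigenvalue sequence $\{\theta_i\}_{i=0}^d$ and dual eigenvalue sequence $\{\theta^*_i\}_{i=0}^d$. Suppose there exist scalars $\varphi_1,\dots,\varphi_d\in\mathbb F$ and a basis $\{u_i\}_{i=0}^d$ of $V$ with respect to which $A$ is represented by the lower bidiagonal matrix with diagonal entries $\theta_0,\dots,\theta_d$ and all subdiagonal entries $1$, and $A^*$ by the upper bidiagonal matrix with diagonal entries $\theta^*_0,\dots,\theta^*_d$ and superdiagonal entries $\varphi_1,\dots,\varphi_d$; let $U_i$ be the span of $u_i$. Then for $1\le i\le d$ the following are equivalent: (i) $E_{i-1}A^*E_i\neq0$; (ii) $(A^*-\theta^*_iI)U_i=U_{i-1}$; (iii) $\varphi_i\neq0$.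
   Context: Let $\mathbb F$ be a field, $d\ge0$ an integer, $V$ an $\mathbb F$-vector space of dimension $d+1$. A matrix $M$ represents $X\in{\rm End}(V)$ with respect to a basis $\{v_i\}$ if $Xv_j=\sum_i M_{ij}v_i$. An element $A\in{\rm End}(V)$ is multiplicity-free if it has $d+1$ mutually distinct eigenvalues in $\mathbb F$; its primitive idempotent for an eigenvalue $\theta$ is the projection onto the $\theta$-eigenspace along the sum of the other eigenspaces. A pre Leonard system on $V$ is a sequence $(A;\{E_i\}_{i=0}^d;A^*;\{E^*_i\}_{i=0}^d)$ of elements of ${\rm End}(V)$ ($A^*$ is a second arbitrary element, not an adjoint) such that $A,A^*$ are multiplicity-free, $E_0,\dots,E_d$ is an ordering of the primitive idempotents of $A$ and $E^*_0,\dots,E^*_d$ is an ordering of the primitive idempotents of $A^*$. Its eigenvalue sequence is $\{\theta_i\}$ with $AE_i=\theta_iE_i$, and its dual eigenvalue sequence is $\{\theta^*_i\}$ with $A^*E^*_i=\theta^*_iE^*_i$. -}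

module Defs where

open import Level using (_⊔_) renaming (suc to lsuc)
open import Data.Nat as ℕ using (ℕ; zero; suc)
open import Data.Fin as Fin using (Fin; toℕ)
open import Data.Product using (Σ; _×_; _,_)
open import Relation.Nullary using (¬_; yes; no)
open import Relation.Binary.PropositionalEquality using (_≡_)
open import Algebra.Bundles using (CommutativeRing)

record Field c ℓ : Set (lsuc (c ⊔ ℓ)) where
  field
    commutativeRing : CommutativeRing c ℓ
  open CommutativeRing commutativeRing public
  field
    1≉0 : ¬ (1# ≈ 0#)
    inv : ∀ x → ¬ (x ≈ 0#) → Σ Carrier (λ y → x * y ≈ 1#)

-- Linear algebra on V = F^n (vectors Fin n → F); End(V) = n×n matrices,
-- a matrix X acting by (X v) i = Σ_j X i j * v j.
module LinAlg {c ℓ} (F : Field c ℓ) where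
  open Field F hiding (Carrier; 0#; _≈_)
  open Field F public using (Carrier; 0#; _≈_)

  infix 4 _≈ᵥ_ _≈ₘ_
  infixl 6 _+ᵥ_ _-ᵥ_
  infixr 7 _·_
  infixl 8 _∘ₘ_
  infix 9 _⟨_⟩

  Vec : ℕ → Set c
  Vec n = Fin n → Carrier

  Mat : ℕ → Set c
  Mat n = Fin n → Fin n → Carrier

  sumF : ∀ {n} → (Fin n → Carrier) → Carrier
  sumF {zero} f = 0#
  sumF {suc n} f = f Fin.zero + sumF (λ i → f (Fin.suc i))

  _≈ᵥ_ : ∀ {n} → Vec n → Vec n → Set ℓ
  v ≈ᵥ w = ∀ i → v i ≈ w i

  _≈ₘ_ : ∀ {n} → Mat n → Mat n → Set ℓ
  M ≈ₘ N = ∀ i j → M i j ≈ N i j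

  0ᵥ : ∀ {n} → Vec n
  0ᵥ i = 0#

  0ₘ : ∀ {n} → Mat n
  0ₘ i j = 0#

  Iₘ : ∀ {n} → Mat n
  Iₘ i j with i Fin.≟ j
  ... | yes _ = 1#
  ... | no _ = 0#

  _·_ : ∀ {n} → Carrier → Vec n → Vec n
  (a · v) i = a * v i

  _+ᵥ_ : ∀ {n} → Vec n → Vec n → Vec n
  (v +ᵥ w) i = v i + w i

  _-ᵥ_ : ∀ {n} → Vec n → Vec n → Vec n
  (v -ᵥ w) i = v i + (- w i)

  sumV : ∀ {n m} → (Fin m → Vec n) → Vec n
  sumV w x = sumF (λ j → w j x)

  _⟨_⟩ : ∀ {n} → Mat n → Vec n → Vec n
  (X ⟨ v ⟩) i = sumF (λ j → X i j * v j)

  _∘ₘ_ : ∀ {n} → Mat n → Mat n → Mat n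
  (X ∘ₘ Y) i j = sumF (λ k → X i k * Y k j)

  _-ₘ_I : ∀ {n} → Mat n → Carrier → Mat n
  (X -ₘ a I) i j = X i j + (- (a * Iₘ i j))

  IsEigenvalue : ∀ {n} → Mat n → Carrier → Set (c ⊔ ℓ)
  IsEigenvalue X θ = Σ (Vec _) (λ v → ¬ (v ≈ᵥ 0ᵥ) × (X ⟨ v ⟩ ≈ᵥ (θ · v)))

  IsMultFreeWith : ∀ {n} → Mat n → (Fin n → Carrier) → Set (c ⊔ ℓ)
  IsMultFreeWith X θ =
    (∀ i j → ¬ (i ≡ j) → ¬ (θ i ≈ θ j)) × (∀ i → IsEigenvalue X (θ i))

  -- E is the primitive idempotent of X for the eigenvalue θ i, where θ lists
  -- all eigenvalues of X: E is the projection onto the (θ i)-eigenspace along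
  -- the sum of the eigenspaces for the other eigenvalues θ j (j ≠ i), i.e.
  -- for every v, E v lies in the (θ i)-eigenspace and v - E v is a sum of
  -- vectors w j (j ≠ i, w i = 0) with w j in the (θ j)-eigenspace.
  IsPrimitiveIdempotent : ∀ {n} → Mat n → (Fin n → Carrier) → Fin n → Mat n → Set (c ⊔ ℓ)
  IsPrimitiveIdempotent X θ i E = ∀ v →
      (X ⟨ E ⟨ v ⟩ ⟩ ≈ᵥ (θ i · (E ⟨ v ⟩)))
    × Σ (Fin _ → Vec _) (λ w →
          (w i ≈ᵥ 0ᵥ)
        × (∀ j → ¬ (j ≡ i) → X ⟨ w j ⟩ ≈ᵥ (θ j · w j))
        × ((v -ᵥ (E ⟨ v ⟩)) ≈ᵥ sumV w))

  IsPreLeonardSystem : ∀ {n} → (A : Mat n) (E : Fin n → Mat n) (As : Mat n) (Es : Fin n → Mat n)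
    (θ θs : Fin n → Carrier) → Set (c ⊔ ℓ)
  IsPreLeonardSystem A E As Es θ θs =
      IsMultFreeWith A θ × (∀ i → IsPrimitiveIdempotent A θ i (E i))
    × IsMultFreeWith As θs × (∀ i → IsPrimitiveIdempotent As θs i (Es i))

  IsBasis : ∀ {n} → (Fin n → Vec n) → Set (c ⊔ ℓ)
  IsBasis u =
      (∀ (a : Fin _ → Carrier) → sumV (λ i → a i · u i) ≈ᵥ 0ᵥ → ∀ i → a i ≈ 0#)
    × (∀ v → Σ (Fin _ → Carrier) (λ a → v ≈ᵥ sumV (λ i → a i · u i)))

  Represents : ∀ {n} → (Fin n → Vec n) → Mat n → Mat n → Set ℓ
  Represents u X M = ∀ j → X ⟨ u j ⟩ ≈ᵥ sumV (λ i → M i j · u i)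

  lowerBidiag : ∀ {n} → (Fin n → Carrier) → Mat n
  lowerBidiag θ i j with toℕ i ℕ.≟ toℕ j
  ... | yes _ = θ j
  ... | no _ with toℕ i ℕ.≟ suc (toℕ j)
  ...   | yes _ = 1#
  ...   | no _ = 0#

  -- φ k read at natural-number index k (φ : Fin m → F), 0# out of range
  at : ∀ {m} → (Fin m → Carrier) → ℕ → Carrier
  at {zero} φ k = 0#
  at {suc m} φ zero = φ Fin.zero
  at {suc m} φ (suc k) = at (λ x → φ (Fin.suc x)) k

  -- upper bidiagonal matrix: diagonal θs_0..θs_d, superdiagonal φ_1..φ_d,
  -- where φ : Fin d → F and φ_{k+1} = φ k, i.e. entry (k, k+1) is φ k.
  upperBidiag : ∀ {d} → (Fin (suc d) → Carrier) → (Fin d → Carrier) → Mat (suc d)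
  upperBidiag θs φ i j with toℕ i ℕ.≟ toℕ j
  ... | yes _ = θs i
  ... | no _ with toℕ j ℕ.≟ suc (toℕ i)
  ...   | yes _ = at φ (toℕ i)
  ...   | no _ = 0#

  Span1 : ∀ {n} → Vec n → Vec n → Set (c ⊔ ℓ)
  Span1 u v = Σ Carrier (λ a → v ≈ᵥ (a · u))

  Image : ∀ {n} → Mat n → (Vec n → Set (c ⊔ ℓ)) → Vec n → Set (c ⊔ ℓ)
  Image X P v = Σ (Vec _) (λ w → P w × (v ≈ᵥ X ⟨ w ⟩))

  SameSubset : ∀ {n} → (Vec n → Set (c ⊔ ℓ)) → (Vec n → Set (c ⊔ ℓ)) → Set (c ⊔ ℓ)
  SameSubset P Q = ∀ v → (P v → Q v) × (Q v → P v)

-- Write A and A* in the basis u as the lower bidiagonal L and the upper bidiagonal U.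
-- For each m, ρ_m(s) = ∏_{s' < s} (θ_m − θ_s') is a left eigenvector of L for θ_m that
-- vanishes beyond m but not up to m, so the functional ψ_m v = Σ_t ρ_m(t) v_t (v_t the
-- coordinates of v) annihilates the θ_j-eigenvectors of A for j ≠ m, whence ψ_m ∘ E_m = ψ_m.
-- An eigenvector of L for θ_m has no coordinates below m, and is 0 if its m-th coordinate is.
-- For x = E_i v the coordinates of A* x below i − 1 vanish and the (i − 1)-st is φ_i x_i, so
-- applying ψ_{i−1} to E_{i−1} A* x gives (E_{i−1} A* E_i v)_{i−1} = φ_i (E_i v)_i; since
-- (E_i u_i)_i = 1 this is (i) ⇔ (iii). Finally (A* − θ*_i I) u_i = φ_i u_{i−1}, so A* − θ*_i I
-- maps U_i onto U_{i−1} exactly when φ_i ≠ 0.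

module Submission where

open import Defs
open import Data.Nat using (ℕ; suc)
open import Data.Fin as Fin using (Fin; inject₁)
open import Data.Product using (_×_)
open import Relation.Nullary using (¬_)
open import Function.Bundles using (_⇔_)

open import Data.Nat as ℕ using (zero; _≡ᵇ_; _<_; _≤_; s≤s)
import Data.Nat.Properties as ℕ
import Data.Fin.Properties as Fin
open import Data.Fin using (toℕ; fromℕ<)
open import Data.Bool using (if_then_else_)
open import Data.Product using (_,_; proj₁; proj₂)
open import Data.Sum using (inj₁; inj₂)
open import Data.Empty using (⊥-elim)
open import Relation.Binary.Definitions using (tri<; tri≈; tri>)
open import Relation.Binary.PropositionalEquality as ≡ using (_≡_)
open import Relation.Nullary using (yes; no)
open import Function.Bundles using (mk⇔; Equivalence)
open import Function.Construct.Composition using (_⇔-∘_)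
open import Function.Construct.Symmetry using (⇔-sym)
open import Function.Related.TypeIsomorphisms using (¬-cong-⇔)

module FieldProperties {c ℓ} (F : Field c ℓ) where
  open Field F
  open import Algebra.Properties.Ring ring using (x∙y⁻¹≈ε⇒x≈y; x≈y⇒x∙y⁻¹≈ε; x[y-z]≈xy-xz)
  open import Relation.Binary.Reasoning.Setoid setoid

  x≉0⇒x*y≈0⇒y≈0 : ∀ {x y} → ¬ x ≈ 0# → x * y ≈ 0# → y ≈ 0#
  x≉0⇒x*y≈0⇒y≈0 {x} {y} x≉0 xy≈0 with inv x x≉0
  ... | x⁻¹ , xx⁻¹≈1 = begin
    y               ≈⟨ *-identityˡ y ⟨
    1# * y          ≈⟨ *-congʳ (trans (sym xx⁻¹≈1) (*-comm x x⁻¹)) ⟩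
    (x⁻¹ * x) * y   ≈⟨ *-assoc x⁻¹ x y ⟩
    x⁻¹ * (x * y)   ≈⟨ *-congˡ xy≈0 ⟩
    x⁻¹ * 0#        ≈⟨ zeroʳ x⁻¹ ⟩
    0# ∎

  x≉0∧y≉0⇒x*y≉0 : ∀ {x y} → ¬ x ≈ 0# → ¬ y ≈ 0# → ¬ x * y ≈ 0#
  x≉0∧y≉0⇒x*y≉0 x≉0 y≉0 xy≈0 = y≉0 (x≉0⇒x*y≈0⇒y≈0 x≉0 xy≈0)

  x≉y⇒x-y≉0 : ∀ {x y} → ¬ x ≈ y → ¬ x - y ≈ 0#
  x≉y⇒x-y≉0 x≉y x-y≈0 = x≉y (x∙y⁻¹≈ε⇒x≈y _ _ x-y≈0)

  *-cancelˡ-≉0 : ∀ {x y z} → ¬ x ≈ 0# → x * y ≈ x * z → y ≈ z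
  *-cancelˡ-≉0 {x} {y} {z} x≉0 xy≈xz = x∙y⁻¹≈ε⇒x≈y y z (x≉0⇒x*y≈0⇒y≈0 x≉0 (begin
    x * (y - z)       ≈⟨ x[y-z]≈xy-xz x y z ⟩
    x * y - x * z     ≈⟨ x≈y⇒x∙y⁻¹≈ε xy≈xz ⟩
    0#                ∎))

module Summation {c ℓ} (F : Field c ℓ) where
  open Field F hiding (Carrier; 0#; _≈_; zero)
  open LinAlg F
  open import Algebra.Properties.Semiring.Sum semiring
  open import Algebra.Properties.Ring ring using (-1*x≈-x)
  open import Relation.Binary.Reasoning.Setoid setoid

  sumF≡sum : ∀ {n} (f : Fin n → Carrier) → sumF f ≡ sum f
  sumF≡sum {zero} f = ≡.refl
  sumF≡sum {suc n} f = ≡.cong (f Fin.zero +_) (sumF≡sum (λ i → f (Fin.suc i)))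

  sumF-cong : ∀ {n} {f g : Fin n → Carrier} → (∀ i → f i ≈ g i) → sumF f ≈ sumF g
  sumF-cong {f = f} {g} f≈g = begin
    sumF f  ≡⟨ sumF≡sum f ⟩
    sum f   ≈⟨ sum-cong-≋ f≈g ⟩
    sum g   ≡⟨ sumF≡sum g ⟨
    sumF g ∎

  sumF-zero : ∀ {n} {f : Fin n → Carrier} → (∀ i → f i ≈ 0#) → sumF f ≈ 0#
  sumF-zero {n} {f} f≈0 = begin
    sumF f                ≈⟨ sumF-cong f≈0 ⟩
    sumF {n} (λ _ → 0#)   ≡⟨ sumF≡sum {n} (λ _ → 0#) ⟩
    sum {n} (λ _ → 0#)    ≈⟨ sum-replicate-zero n ⟩
    0# ∎

  sumF-distrib-+ : ∀ {n} (f g : Fin n → Carrier) → sumF (λ i → f i + g i) ≈ sumF f + sumF g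
  sumF-distrib-+ f g
    rewrite sumF≡sum (λ i → f i + g i) | sumF≡sum f | sumF≡sum g = ∑-distrib-+ f g

  *-distribˡ-sumF : ∀ {n} a (f : Fin n → Carrier) → a * sumF f ≈ sumF (λ i → a * f i)
  *-distribˡ-sumF a f rewrite sumF≡sum f | sumF≡sum (λ i → a * f i) = *-distribˡ-sum a f

  *-distribʳ-sumF : ∀ {n} a (f : Fin n → Carrier) → sumF f * a ≈ sumF (λ i → f i * a)
  *-distribʳ-sumF a f rewrite sumF≡sum f | sumF≡sum (λ i → f i * a) = *-distribʳ-sum a f

  -‿sumF : ∀ {n} (f : Fin n → Carrier) → - sumF f ≈ sumF (λ i → - f i)
  -‿sumF f = begin
    - sumF f                  ≈⟨ -1*x≈-x (sumF f) ⟨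
    - 1# * sumF f             ≈⟨ *-distribˡ-sumF (- 1#) f ⟩
    sumF (λ i → - 1# * f i)   ≈⟨ sumF-cong (λ i → -1*x≈-x (f i)) ⟩
    sumF (λ i → - f i) ∎

  sumF-single : ∀ {n} (f : Fin n → Carrier) j → (∀ i → ¬ i ≡ j → f i ≈ 0#) → sumF f ≈ f j
  sumF-single f Fin.zero f≈0 =
    trans (+-congˡ (sumF-zero (λ i → f≈0 (Fin.suc i) (λ ())))) (+-identityʳ _)
  sumF-single f (Fin.suc j) f≈0 = trans (+-congʳ (f≈0 Fin.zero (λ ()))) (trans (+-identityˡ _)
    (sumF-single (λ i → f (Fin.suc i)) j
      (λ i i≢j → f≈0 (Fin.suc i) (λ eq → i≢j (Fin.suc-injective eq)))))

  sumF-comm : ∀ {m n} (h : Fin m → Fin n → Carrier) →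
    sumF (λ i → sumF (h i)) ≈ sumF (λ j → sumF (λ i → h i j))
  sumF-comm h = begin
    sumF (λ i → sumF (h i))              ≡⟨ sumF≡sum (λ i → sumF (h i)) ⟩
    sum (λ i → sumF (h i))               ≡⟨ sum-cong-≗ (λ i → sumF≡sum (h i)) ⟩
    sum (λ i → sum (h i))                ≈⟨ ∑-comm h ⟩
    sum (λ j → sum (λ i → h i j))        ≡⟨ sum-cong-≗ (λ j → sumF≡sum (λ i → h i j)) ⟨
    sum (λ j → sumF (λ i → h i j))       ≡⟨ sumF≡sum (λ j → sumF (λ i → h i j)) ⟨
    sumF (λ j → sumF (λ i → h i j)) ∎

module FinSequences {c ℓ} (F : Field c ℓ) where
  open Field F hiding (Carrier; 0#; _≈_; zero)
  open LinAlg F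
  open Summation F

  δ : ℕ → ℕ → Carrier
  δ m n = if m ≡ᵇ n then 1# else 0#

  δ-refl : ∀ n → δ n n ≡ 1#
  δ-refl zero = ≡.refl
  δ-refl (suc n) = δ-refl n

  δ-≢ : ∀ {m n} → ¬ m ≡ n → δ m n ≡ 0#
  δ-≢ {zero} {zero} m≢n = ⊥-elim (m≢n ≡.refl)
  δ-≢ {zero} {suc n} m≢n = ≡.refl
  δ-≢ {suc m} {zero} m≢n = ≡.refl
  δ-≢ {suc m} {suc n} m≢n = δ-≢ (λ m≡n → m≢n (≡.cong suc m≡n))

  δ-sym : ∀ m n → δ m n ≡ δ n m
  δ-sym zero zero = ≡.refl
  δ-sym zero (suc n) = ≡.refl
  δ-sym (suc m) zero = ≡.refl
  δ-sym (suc m) (suc n) = δ-sym m n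

  Iₘ≡δ : ∀ {n} (i j : Fin n) → Iₘ i j ≡ δ (toℕ i) (toℕ j)
  Iₘ≡δ i j with i Fin.≟ j
  ... | yes ≡.refl = ≡.sym (δ-refl (toℕ i))
  ... | no i≢j = ≡.sym (δ-≢ (λ eq → i≢j (Fin.toℕ-injective eq)))

  at-toℕ : ∀ {n} (f : Fin n → Carrier) (i : Fin n) → at f (toℕ i) ≡ f i
  at-toℕ f Fin.zero = ≡.refl
  at-toℕ f (Fin.suc i) = at-toℕ (λ j → f (Fin.suc j)) i

  at-inject₁ : ∀ {n} (f : Fin (suc n) → Carrier) (i : Fin n) → at f (toℕ i) ≡ f (inject₁ i)
  at-inject₁ f i = ≡.trans (≡.cong (at f) (≡.sym (Fin.toℕ-inject₁ i))) (at-toℕ f (inject₁ i))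

  at-toℕ-inject₁ : ∀ {n} (f : Fin n → Carrier) (i : Fin n) → at f (toℕ (inject₁ i)) ≡ f i
  at-toℕ-inject₁ f i = ≡.trans (≡.cong (at f) (Fin.toℕ-inject₁ i)) (at-toℕ f i)

  at-fromℕ< : ∀ {n} (f : Fin n → Carrier) {s} (s<n : s < n) → at f s ≡ f (fromℕ< s<n)
  at-fromℕ< f s<n = ≡.trans (≡.cong (at f) (≡.sym (Fin.toℕ-fromℕ< s<n))) (at-toℕ f (fromℕ< s<n))

  at-≥ : ∀ {n} (f : Fin n → Carrier) {s} → n ≤ s → at f s ≡ 0#
  at-≥ {zero} f _ = ≡.refl
  at-≥ {suc n} f (s≤s n≤s) = at-≥ (λ j → f (Fin.suc j)) n≤s

  at-∘toℕ : ∀ {n} (α : ℕ → Carrier) {s} → s < n → at {n} (λ t → α (toℕ t)) s ≡ α s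
  at-∘toℕ {suc n} α {zero} _ = ≡.refl
  at-∘toℕ {suc n} α {suc s} (s≤s s<n) = at-∘toℕ (λ s → α (suc s)) s<n

  VanishesBelow : ∀ {n} → ℕ → Vec n → Set ℓ
  VanishesBelow m a = ∀ s → s < m → at a s ≈ 0#

  sumF-δ : ∀ {n} (f : Fin n → Carrier) s → sumF (λ t → f t * δ (toℕ t) s) ≈ at f s
  sumF-δ {zero} f s = refl
  sumF-δ {suc n} f zero =
    trans (+-cong (*-identityʳ _) (sumF-zero {f = λ t → f (Fin.suc t) * 0#} (λ t → zeroʳ _)))
      (+-identityʳ _)
  sumF-δ {suc n} f (suc s) =
    trans (+-cong (zeroʳ _) (sumF-δ (λ t → f (Fin.suc t)) s)) (+-identityˡ _)

  sumF-δ′ : ∀ {n} (f : Fin n → Carrier) s → sumF (λ t → f t * δ s (toℕ t)) ≈ at f s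
  sumF-δ′ f s = trans (sumF-cong (λ t → *-congˡ {f t} (reflexive (δ-sym s (toℕ t))))) (sumF-δ f s)

module MatrixAction {c ℓ} (F : Field c ℓ) where
  open Field F hiding (Carrier; 0#; _≈_; zero)
  open LinAlg F
  open Summation F
  open FinSequences F
  open import Algebra.Properties.Ring ring using ([y-z]x≈yx-zx)
  open import Algebra.Properties.CommutativeSemigroup *-commutativeSemigroup
    using (x∙yz≈y∙xz; xy∙z≈xz∙y)
  open import Relation.Binary.Reasoning.Setoid setoid

  ⟨⟩-cong : ∀ {n} (X : Mat n) {v w : Vec n} → v ≈ᵥ w → X ⟨ v ⟩ ≈ᵥ X ⟨ w ⟩
  ⟨⟩-cong X v≈w i = sumF-cong (λ j → *-congˡ (v≈w j))

  ⟨⟩-scale : ∀ {n} (X : Mat n) a (v : Vec n) → X ⟨ a · v ⟩ ≈ᵥ a · X ⟨ v ⟩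
  ⟨⟩-scale X a v i = begin
    sumF (λ j → X i j * (a * v j))   ≈⟨ sumF-cong (λ j → x∙yz≈y∙xz (X i j) a (v j)) ⟩
    sumF (λ j → a * (X i j * v j))   ≈⟨ *-distribˡ-sumF a (λ j → X i j * v j) ⟨
    a * sumF (λ j → X i j * v j) ∎

  ∘ₘ-⟨⟩ : ∀ {n} (X Y : Mat n) (v : Vec n) → (X ∘ₘ Y) ⟨ v ⟩ ≈ᵥ X ⟨ Y ⟨ v ⟩ ⟩
  ∘ₘ-⟨⟩ X Y v i = begin
    sumF (λ j → sumF (λ k → X i k * Y k j) * v j)
      ≈⟨ sumF-cong (λ j → *-distribʳ-sumF (v j) (λ k → X i k * Y k j)) ⟩
    sumF (λ j → sumF (λ k → (X i k * Y k j) * v j))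
      ≈⟨ sumF-comm (λ j k → (X i k * Y k j) * v j) ⟩
    sumF (λ k → sumF (λ j → (X i k * Y k j) * v j))
      ≈⟨ sumF-cong (λ k → sumF-cong (λ j → *-assoc (X i k) (Y k j) (v j))) ⟩
    sumF (λ k → sumF (λ j → X i k * (Y k j * v j)))
      ≈⟨ sumF-cong (λ k → *-distribˡ-sumF (X i k) (λ j → Y k j * v j)) ⟨
    sumF (λ k → X i k * sumF (λ j → Y k j * v j)) ∎

  ∘ₘ-∘ₘ-⟨⟩ : ∀ {n} (X Y Z : Mat n) (v : Vec n) → ((X ∘ₘ Y) ∘ₘ Z) ⟨ v ⟩ ≈ᵥ X ⟨ Y ⟨ Z ⟨ v ⟩ ⟩ ⟩
  ∘ₘ-∘ₘ-⟨⟩ X Y Z v p = trans (∘ₘ-⟨⟩ (X ∘ₘ Y) Z v p) (∘ₘ-⟨⟩ X Y (Z ⟨ v ⟩) p)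

  -ₘI-⟨⟩ : ∀ {n} (X : Mat n) a (v : Vec n) i → ((X -ₘ a I) ⟨ v ⟩) i ≈ (X ⟨ v ⟩) i - a * v i
  -ₘI-⟨⟩ X a v i = begin
    sumF (λ j → (X i j - a * Iₘ i j) * v j)
      ≈⟨ sumF-cong (λ j → [y-z]x≈yx-zx (v j) (X i j) (a * Iₘ i j)) ⟩
    sumF (λ j → X i j * v j - (a * Iₘ i j) * v j)
      ≈⟨ sumF-distrib-+ (λ j → X i j * v j) (λ j → - ((a * Iₘ i j) * v j)) ⟩
    (X ⟨ v ⟩) i + sumF (λ j → - ((a * Iₘ i j) * v j))
      ≈⟨ +-congˡ (-‿sumF (λ j → (a * Iₘ i j) * v j)) ⟨
    (X ⟨ v ⟩) i - sumF (λ j → (a * Iₘ i j) * v j)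
      ≈⟨ +-congˡ (-‿cong (sumF-cong (λ j → identity-entry j))) ⟩
    (X ⟨ v ⟩) i - sumF (λ j → (a * v j) * δ (toℕ j) (toℕ i))
      ≈⟨ +-congˡ (-‿cong (sumF-δ (λ j → a * v j) (toℕ i))) ⟩
    (X ⟨ v ⟩) i - at (λ j → a * v j) (toℕ i)
      ≡⟨ ≡.cong (λ x → (X ⟨ v ⟩) i - x) (at-toℕ (λ j → a * v j) i) ⟩
    (X ⟨ v ⟩) i - a * v i ∎
    where
    identity-entry : ∀ j → (a * Iₘ i j) * v j ≈ (a * v j) * δ (toℕ j) (toℕ i)
    identity-entry j = trans (xy∙z≈xz∙y a (Iₘ i j) (v j))
      (*-congˡ (reflexive (≡.trans (Iₘ≡δ i j) (δ-sym (toℕ i) (toℕ j)))))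

  IsLeftEigenvector : ∀ {n} → Mat n → Carrier → (Fin n → Carrier) → Set ℓ
  IsLeftEigenvector M μ ρ = ∀ j → sumF (λ t → ρ t * M t j) ≈ μ * ρ j

  unitVec : ∀ {n} → Fin n → Vec n
  unitVec j t = δ (toℕ t) (toℕ j)

  ⟨unitVec⟩ : ∀ {n} (X : Mat n) i j → (X ⟨ unitVec j ⟩) i ≈ X i j
  ⟨unitVec⟩ X i j = trans (sumF-δ (X i) (toℕ j)) (reflexive (at-toℕ (X i) j))

  ≈0ₘ⇔⟨⟩≈0ᵥ : ∀ {n} (M : Mat n) → (M ≈ₘ 0ₘ) ⇔ (∀ v → M ⟨ v ⟩ ≈ᵥ 0ᵥ)
  ≈0ₘ⇔⟨⟩≈0ᵥ M = mk⇔
    (λ M≈0 v i → sumF-zero (λ j → trans (*-congʳ (M≈0 i j)) (zeroˡ (v j))))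
    (λ M⟨⟩≈0 i j → trans (sym (⟨unitVec⟩ M i j)) (M⟨⟩≈0 (unitVec j) i))

  image-Span1⇔ : ∀ {n} (Y : Mat n) {w w′ : Vec n} {a} → Y ⟨ w ⟩ ≈ᵥ a · w′ → ¬ w′ ≈ᵥ 0ᵥ →
    SameSubset (Image Y (Span1 w)) (Span1 w′) ⇔ (¬ a ≈ 0#)
  image-Span1⇔ Y {w} {w′} {a} Yw≈aw′ w′≉0 = mk⇔ a≉0 same
    where
    Y-scale : ∀ b → Y ⟨ b · w ⟩ ≈ᵥ (b * a) · w′
    Y-scale b p = trans (⟨⟩-scale Y b w p) (trans (*-congˡ (Yw≈aw′ p)) (sym (*-assoc b a (w′ p))))

    a≉0 : SameSubset (Image Y (Span1 w)) (Span1 w′) → ¬ a ≈ 0#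
    a≉0 same a≈0 with proj₂ (same w′) (1# , λ p → sym (*-identityˡ (w′ p)))
    ... | x , (b , x≈bw) , w′≈Yx = w′≉0 (λ p → begin
      w′ p               ≈⟨ w′≈Yx p ⟩
      (Y ⟨ x ⟩) p        ≈⟨ ⟨⟩-cong Y x≈bw p ⟩
      (Y ⟨ b · w ⟩) p    ≈⟨ Y-scale b p ⟩
      (b * a) * w′ p     ≈⟨ *-congʳ (trans (*-congˡ a≈0) (zeroʳ b)) ⟩
      0# * w′ p          ≈⟨ zeroˡ (w′ p) ⟩
      0# ∎)

    same : ¬ a ≈ 0# → SameSubset (Image Y (Span1 w)) (Span1 w′)
    same a≉0 v = image⊆ , ⊆image
      where
      image⊆ : Image Y (Span1 w) v → Span1 w′ v
      image⊆ (x , (b , x≈bw) , v≈Yx) =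
        b * a , λ p → trans (v≈Yx p) (trans (⟨⟩-cong Y x≈bw p) (Y-scale b p))
      a⁻¹ : Carrier
      a⁻¹ = proj₁ (inv a a≉0)
      a⁻¹a≈1 : a⁻¹ * a ≈ 1#
      a⁻¹a≈1 = trans (*-comm a⁻¹ a) (proj₂ (inv a a≉0))
      ⊆image : Span1 w′ v → Image Y (Span1 w) v
      ⊆image (b , v≈bw′) = (b * a⁻¹) · w , (b * a⁻¹ , λ p → refl) , λ p → begin
        v p                           ≈⟨ v≈bw′ p ⟩
        b * w′ p                      ≈⟨ *-congʳ (*-identityʳ b) ⟨
        (b * 1#) * w′ p               ≈⟨ *-congʳ (*-congˡ a⁻¹a≈1) ⟨
        (b * (a⁻¹ * a)) * w′ p        ≈⟨ *-congʳ (*-assoc b a⁻¹ a) ⟨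
        ((b * a⁻¹) * a) * w′ p        ≈⟨ Y-scale (b * a⁻¹) p ⟨
        (Y ⟨ (b * a⁻¹) · w ⟩) p ∎

module Coordinates {c ℓ} (F : Field c ℓ) {n} (u : Fin n → LinAlg.Vec F n) (basis : LinAlg.IsBasis F u) where
  open Field F hiding (Carrier; 0#; _≈_; zero)
  open LinAlg F
  open Summation F
  open FinSequences F
  open MatrixAction F
  open FieldProperties F
  open import Algebra.Properties.Ring ring
    using ([y-z]x≈yx-zx; x[y-z]≈xy-xz; x∙y⁻¹≈ε⇒x≈y; x≈y⇒x∙y⁻¹≈ε)
  open import Algebra.Properties.CommutativeSemigroup *-commutativeSemigroup
    using (x∙yz≈y∙xz; x∙yz≈yx∙z)
  open import Relation.Binary.Reasoning.Setoid setoid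

  lincomb : (Fin n → Carrier) → Vec n
  lincomb a = sumV (λ i → a i · u i)

  coef : Vec n → Fin n → Carrier
  coef v = proj₁ (proj₂ basis v)

  ≈lincomb-coef : ∀ v → v ≈ᵥ lincomb (coef v)
  ≈lincomb-coef v = proj₂ (proj₂ basis v)

  lincomb-sub : ∀ a b x → lincomb a x - lincomb b x ≈ lincomb (λ i → a i - b i) x
  lincomb-sub a b x = begin
    lincomb a x - lincomb b x
      ≈⟨ +-congˡ (-‿sumF (λ i → b i * u i x)) ⟩
    lincomb a x + sumF (λ i → - (b i * u i x))
      ≈⟨ sumF-distrib-+ (λ i → a i * u i x) (λ i → - (b i * u i x)) ⟨
    sumF (λ i → a i * u i x - b i * u i x)
      ≈⟨ sumF-cong (λ i → [y-z]x≈yx-zx (u i x) (a i) (b i)) ⟨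
    lincomb (λ i → a i - b i) x ∎

  coef-unique : ∀ {v} a → v ≈ᵥ lincomb a → ∀ i → coef v i ≈ a i
  coef-unique {v} a v≈a i = x∙y⁻¹≈ε⇒x≈y _ _ (proj₁ basis (λ i → coef v i - a i) difference≈0 i)
    where
    difference≈0 : lincomb (λ i → coef v i - a i) ≈ᵥ 0ᵥ
    difference≈0 x = begin
      lincomb (λ i → coef v i - a i) x   ≈⟨ lincomb-sub (coef v) a x ⟨
      lincomb (coef v) x - lincomb a x   ≈⟨ x≈y⇒x∙y⁻¹≈ε (trans (sym (≈lincomb-coef v x)) (v≈a x)) ⟩
      0# ∎

  coef-cong : ∀ {v w} → v ≈ᵥ w → ∀ i → coef v i ≈ coef w i
  coef-cong {w = w} v≈w = coef-unique (coef w) (λ x → trans (v≈w x) (≈lincomb-coef w x))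

  coef-zero : ∀ {v} → v ≈ᵥ 0ᵥ → ∀ i → coef v i ≈ 0#
  coef-zero v≈0 = coef-unique (λ _ → 0#) (λ x → trans (v≈0 x) (sym (sumF-zero (λ i → zeroˡ (u i x)))))

  coef≈0⇒≈0ᵥ : ∀ {v} → (∀ i → coef v i ≈ 0#) → v ≈ᵥ 0ᵥ
  coef≈0⇒≈0ᵥ {v} coef≈0 x =
    trans (≈lincomb-coef v x) (sumF-zero (λ i → trans (*-congʳ (coef≈0 i)) (zeroˡ _)))

  coef-sub : ∀ v w i → coef (v -ᵥ w) i ≈ coef v i - coef w i
  coef-sub v w = coef-unique (λ i → coef v i - coef w i) (λ x →
    trans (+-cong (≈lincomb-coef v x) (-‿cong (≈lincomb-coef w x))) (lincomb-sub (coef v) (coef w) x))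

  coef-scale : ∀ a v i → coef (a · v) i ≈ a * coef v i
  coef-scale a v = coef-unique (λ i → a * coef v i) (λ x → begin
    a * v x                                ≈⟨ *-congˡ (≈lincomb-coef v x) ⟩
    a * sumF (λ i → coef v i * u i x)      ≈⟨ *-distribˡ-sumF a (λ i → coef v i * u i x) ⟩
    sumF (λ i → a * (coef v i * u i x))    ≈⟨ sumF-cong (λ i → *-assoc a (coef v i) (u i x)) ⟨
    lincomb (λ i → a * coef v i) x ∎)

  coef-sumV : ∀ {m} (w : Fin m → Vec n) i → coef (sumV w) i ≈ sumF (λ l → coef (w l) i)
  coef-sumV w = coef-unique (λ i → sumF (λ l → coef (w l) i)) (λ x → begin
    sumF (λ l → w l x)
      ≈⟨ sumF-cong (λ l → ≈lincomb-coef (w l) x) ⟩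
    sumF (λ l → sumF (λ i → coef (w l) i * u i x))
      ≈⟨ sumF-comm (λ l i → coef (w l) i * u i x) ⟩
    sumF (λ i → sumF (λ l → coef (w l) i * u i x))
      ≈⟨ sumF-cong (λ i → *-distribʳ-sumF (u i x) (λ l → coef (w l) i)) ⟨
    lincomb (λ i → sumF (λ l → coef (w l) i)) x ∎)

  coef-basis : ∀ j i → coef (u j) i ≈ δ (toℕ i) (toℕ j)
  coef-basis j = coef-unique (λ i → δ (toℕ i) (toℕ j)) (λ x → begin
    u j x                                     ≡⟨ at-toℕ (λ t → u t x) j ⟨
    at (λ t → u t x) (toℕ j)                  ≈⟨ sumF-δ (λ t → u t x) (toℕ j) ⟨
    sumF (λ t → u t x * δ (toℕ t) (toℕ j))    ≈⟨ sumF-cong (λ t → *-comm (u t x) _) ⟩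
    lincomb (λ i → δ (toℕ i) (toℕ j)) x ∎)

  coef-⟨⟩ : ∀ {X M : Mat n} → Represents u X M → ∀ v → coef (X ⟨ v ⟩) ≈ᵥ M ⟨ coef v ⟩
  coef-⟨⟩ {X} {M} rep v = coef-unique (M ⟨ coef v ⟩) (λ x → begin
    (X ⟨ v ⟩) x
      ≈⟨ ⟨⟩-cong X (≈lincomb-coef v) x ⟩
    sumF (λ y → X x y * sumF (λ j → a j * u j y))
      ≈⟨ sumF-cong (λ y → *-distribˡ-sumF (X x y) (λ j → a j * u j y)) ⟩
    sumF (λ y → sumF (λ j → X x y * (a j * u j y)))
      ≈⟨ sumF-comm (λ y j → X x y * (a j * u j y)) ⟩
    sumF (λ j → sumF (λ y → X x y * (a j * u j y)))
      ≈⟨ sumF-cong (λ j → sumF-cong (λ y → x∙yz≈y∙xz (X x y) (a j) (u j y))) ⟩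
    sumF (λ j → sumF (λ y → a j * (X x y * u j y)))
      ≈⟨ sumF-cong (λ j → *-distribˡ-sumF (a j) (λ y → X x y * u j y)) ⟨
    sumF (λ j → a j * (X ⟨ u j ⟩) x)
      ≈⟨ sumF-cong (λ j → *-congˡ (rep j x)) ⟩
    sumF (λ j → a j * sumF (λ t → M t j * u t x))
      ≈⟨ sumF-cong (λ j → *-distribˡ-sumF (a j) (λ t → M t j * u t x)) ⟩
    sumF (λ j → sumF (λ t → a j * (M t j * u t x)))
      ≈⟨ sumF-comm (λ j t → a j * (M t j * u t x)) ⟩
    sumF (λ t → sumF (λ j → a j * (M t j * u t x)))
      ≈⟨ sumF-cong (λ t → sumF-cong (λ j → x∙yz≈yx∙z (a j) (M t j) (u t x))) ⟩
    sumF (λ t → sumF (λ j → (M t j * a j) * u t x))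
      ≈⟨ sumF-cong (λ t → *-distribʳ-sumF (u t x) (λ j → M t j * a j)) ⟨
    lincomb (M ⟨ a ⟩) x ∎)
    where
    a : Fin n → Carrier
    a = coef v

  coef-eigenvector : ∀ {X M : Mat n} {μ w} → Represents u X M → X ⟨ w ⟩ ≈ᵥ μ · w →
    M ⟨ coef w ⟩ ≈ᵥ μ · coef w
  coef-eigenvector {μ = μ} {w} rep Xw≈μw t =
    trans (sym (coef-⟨⟩ rep w t)) (trans (coef-cong Xw≈μw t) (coef-scale μ w t))

  basis-≉0 : ∀ j → ¬ u j ≈ᵥ 0ᵥ
  basis-≉0 j uj≈0 = 1≉0 (begin
    1#                        ≡⟨ δ-refl (toℕ j) ⟨
    δ (toℕ j) (toℕ j)         ≈⟨ coef-basis j j ⟨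
    coef (u j) j              ≈⟨ coef-zero uj≈0 j ⟩
    0# ∎)

  form : (Fin n → Carrier) → Vec n → Carrier
  form ρ v = sumF (λ t → ρ t * coef v t)

  module _ (ρ : Fin n → Carrier) where

    form-cong : ∀ {v w} → v ≈ᵥ w → form ρ v ≈ form ρ w
    form-cong v≈w = sumF-cong (λ t → *-congˡ (coef-cong v≈w t))

    form-zero : ∀ {v} → v ≈ᵥ 0ᵥ → form ρ v ≈ 0#
    form-zero v≈0 = sumF-zero (λ t → trans (*-congˡ (coef-zero v≈0 t)) (zeroʳ (ρ t)))

    form-basis : ∀ j → form ρ (u j) ≈ ρ j
    form-basis j = begin
      sumF (λ t → ρ t * coef (u j) t)            ≈⟨ sumF-cong (λ t → *-congˡ (coef-basis j t)) ⟩
      sumF (λ t → ρ t * δ (toℕ t) (toℕ j))       ≈⟨ sumF-δ ρ (toℕ j) ⟩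
      at ρ (toℕ j)                               ≡⟨ at-toℕ ρ j ⟩
      ρ j ∎

    form-scale : ∀ a v → form ρ (a · v) ≈ a * form ρ v
    form-scale a v = begin
      sumF (λ t → ρ t * coef (a · v) t)   ≈⟨ sumF-cong (λ t → *-congˡ (coef-scale a v t)) ⟩
      sumF (λ t → ρ t * (a * coef v t))   ≈⟨ sumF-cong (λ t → x∙yz≈y∙xz (ρ t) a (coef v t)) ⟩
      sumF (λ t → a * (ρ t * coef v t))   ≈⟨ *-distribˡ-sumF a (λ t → ρ t * coef v t) ⟨
      a * form ρ v ∎

    form-sub : ∀ v w → form ρ (v -ᵥ w) ≈ form ρ v - form ρ w
    form-sub v w = begin
      sumF (λ t → ρ t * coef (v -ᵥ w) t)
        ≈⟨ sumF-cong (λ t → trans (*-congˡ (coef-sub v w t)) (x[y-z]≈xy-xz (ρ t) _ _)) ⟩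
      sumF (λ t → ρ t * coef v t - ρ t * coef w t)
        ≈⟨ sumF-distrib-+ (λ t → ρ t * coef v t) (λ t → - (ρ t * coef w t)) ⟩
      form ρ v + sumF (λ t → - (ρ t * coef w t))
        ≈⟨ +-congˡ (-‿sumF (λ t → ρ t * coef w t)) ⟨
      form ρ v - form ρ w ∎

    form-sumV : ∀ {m} (w : Fin m → Vec n) → form ρ (sumV w) ≈ sumF (λ l → form ρ (w l))
    form-sumV w = begin
      sumF (λ t → ρ t * coef (sumV w) t)
        ≈⟨ sumF-cong (λ t → trans (*-congˡ (coef-sumV w t))
                                  (*-distribˡ-sumF (ρ t) (λ l → coef (w l) t))) ⟩
      sumF (λ t → sumF (λ l → ρ t * coef (w l) t))
        ≈⟨ sumF-comm (λ t l → ρ t * coef (w l) t) ⟩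
      sumF (λ l → form ρ (w l)) ∎

    form-represents : ∀ {X M : Mat n} → Represents u X M →
      ∀ v → form ρ (X ⟨ v ⟩) ≈ sumF (λ t → ρ t * (M ⟨ coef v ⟩) t)
    form-represents rep v = sumF-cong (λ t → *-congˡ (coef-⟨⟩ rep v t))

    form-⟨⟩ : ∀ {X M : Mat n} {μ} → Represents u X M → IsLeftEigenvector M μ ρ →
      ∀ v → form ρ (X ⟨ v ⟩) ≈ μ * form ρ v
    form-⟨⟩ {X} {M} {μ} rep ρM≈μρ v = begin
      form ρ (X ⟨ v ⟩)
        ≈⟨ form-represents rep v ⟩
      sumF (λ t → ρ t * sumF (λ j → M t j * a j))
        ≈⟨ sumF-cong (λ t → *-distribˡ-sumF (ρ t) (λ j → M t j * a j)) ⟩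
      sumF (λ t → sumF (λ j → ρ t * (M t j * a j)))
        ≈⟨ sumF-comm (λ t j → ρ t * (M t j * a j)) ⟩
      sumF (λ j → sumF (λ t → ρ t * (M t j * a j)))
        ≈⟨ sumF-cong (λ j → sumF-cong (λ t → *-assoc (ρ t) (M t j) (a j))) ⟨
      sumF (λ j → sumF (λ t → (ρ t * M t j) * a j))
        ≈⟨ sumF-cong (λ j → trans (sym (*-distribʳ-sumF (a j) (λ t → ρ t * M t j)))
                                  (*-congʳ (ρM≈μρ j))) ⟩
      sumF (λ j → (μ * ρ j) * a j)
        ≈⟨ sumF-cong (λ j → *-assoc μ (ρ j) (a j)) ⟩
      sumF (λ j → μ * (ρ j * a j))
        ≈⟨ *-distribˡ-sumF μ (λ j → ρ j * a j) ⟨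
      μ * form ρ v ∎
      where
      a : Fin n → Carrier
      a = coef v

    form-eigenvector : ∀ {X M : Mat n} {μ ν w} → Represents u X M → IsLeftEigenvector M μ ρ →
      ¬ ν ≈ μ → X ⟨ w ⟩ ≈ᵥ ν · w → form ρ w ≈ 0#
    form-eigenvector {X} {μ = μ} {ν} {w} rep ρM≈μρ ν≉μ Xw≈νw =
      x≉0⇒x*y≈0⇒y≈0 (x≉y⇒x-y≉0 ν≉μ) (begin
        (ν - μ) * form ρ w              ≈⟨ [y-z]x≈yx-zx (form ρ w) ν μ ⟩
        ν * form ρ w - μ * form ρ w     ≈⟨ x≈y⇒x∙y⁻¹≈ε νρw≈μρw ⟩
        0# ∎)
      where
      νρw≈μρw : ν * form ρ w ≈ μ * form ρ w
      νρw≈μρw = trans (sym (form-scale ν w)) (trans (sym (form-cong Xw≈νw)) (form-⟨⟩ rep ρM≈μρ w))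

    form-primitiveIdempotent : ∀ {X M : Mat n} {θ m E} → Represents u X M →
      IsLeftEigenvector M (θ m) ρ → (∀ j → ¬ j ≡ m → ¬ θ j ≈ θ m) →
      IsPrimitiveIdempotent X θ m E → ∀ v → form ρ (E ⟨ v ⟩) ≈ form ρ v
    form-primitiveIdempotent {θ = θ} {m} {E} rep ρM≈θρ θ-distinct E-prim v
      with E-prim v
    ... | _ , w , wm≈0 , w-eigen , v-Ev≈Σw = sym (x∙y⁻¹≈ε⇒x≈y _ _ (begin
      form ρ v - form ρ (E ⟨ v ⟩)   ≈⟨ form-sub v (E ⟨ v ⟩) ⟨
      form ρ (v -ᵥ E ⟨ v ⟩)         ≈⟨ form-cong v-Ev≈Σw ⟩
      form ρ (sumV w)               ≈⟨ form-sumV w ⟩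
      sumF (λ l → form ρ (w l))     ≈⟨ sumF-zero form-w≈0 ⟩
      0#                            ∎))
      where
      form-w≈0 : ∀ l → form ρ (w l) ≈ 0#
      form-w≈0 l with l Fin.≟ m
      ... | yes ≡.refl = form-zero wm≈0
      ... | no l≢m = form-eigenvector rep ρM≈θρ (θ-distinct l l≢m) (w-eigen l l≢m)

module LowerBidiagonal {c ℓ} (F : Field c ℓ) {n} (θ : Fin n → LinAlg.Carrier F) where
  open Field F hiding (Carrier; 0#; _≈_; zero)
  open LinAlg F
  open Summation F
  open FinSequences F
  open MatrixAction F using (IsLeftEigenvector)
  open import Algebra.Properties.Ring ring using ([y-z]x≈yx-zx; x≈y⇒x∙y⁻¹≈ε; xyx⁻¹≈y)
  open import Algebra.Properties.CommutativeSemigroup *-commutativeSemigroup using (xy∙z≈xz∙y)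
  open import Relation.Binary.Reasoning.Setoid setoid

  lowerBidiag-δ : ∀ i j → lowerBidiag θ i j ≈ θ j * δ (toℕ i) (toℕ j) + δ (toℕ i) (suc (toℕ j))
  lowerBidiag-δ i j with toℕ i ℕ.≟ toℕ j
  ... | yes i≡j rewrite i≡j | δ-refl (toℕ j) | δ-≢ {toℕ j} {suc (toℕ j)} (≡.≢-sym ℕ.1+n≢n) =
    sym (trans (+-identityʳ _) (*-identityʳ _))
  ... | no i≢j with toℕ i ℕ.≟ suc (toℕ j)
  ...   | yes i≡1+j rewrite δ-≢ i≢j | i≡1+j | δ-refl (suc (toℕ j)) =
    sym (trans (+-congʳ (zeroʳ _)) (+-identityˡ _))
  ...   | no i≢1+j rewrite δ-≢ i≢j | δ-≢ i≢1+j =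
    sym (trans (+-identityʳ _) (zeroʳ _))

  shift : (ℕ → Carrier) → ℕ → Carrier
  shift α zero = 0#
  shift α (suc s) = α s

  sumF-δ-suc : ∀ (a : Fin n → Carrier) s → sumF (λ j → a j * δ s (suc (toℕ j))) ≈ shift (at a) s
  sumF-δ-suc a zero = sumF-zero (λ j → zeroʳ (a j))
  sumF-δ-suc a (suc s) = sumF-δ′ a s

  lowerBidiag-row : ∀ (a : Vec n) t → (lowerBidiag θ ⟨ a ⟩) t ≈ θ t * a t + shift (at a) (toℕ t)
  lowerBidiag-row a t = begin
    sumF (λ j → lowerBidiag θ t j * a j)
      ≈⟨ sumF-cong entry ⟩
    sumF (λ j → θa j * δ (toℕ t) (toℕ j) + a j * δ (toℕ t) (suc (toℕ j)))
      ≈⟨ sumF-distrib-+ (λ j → θa j * δ (toℕ t) (toℕ j)) (λ j → a j * δ (toℕ t) (suc (toℕ j))) ⟩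
    sumF (λ j → θa j * δ (toℕ t) (toℕ j)) + sumF (λ j → a j * δ (toℕ t) (suc (toℕ j)))
      ≈⟨ +-cong (sumF-δ′ θa (toℕ t)) (sumF-δ-suc a (toℕ t)) ⟩
    at θa (toℕ t) + shift (at a) (toℕ t)
      ≡⟨ ≡.cong (_+ shift (at a) (toℕ t)) (at-toℕ θa t) ⟩
    θ t * a t + shift (at a) (toℕ t) ∎
    where
    θa : Fin n → Carrier
    θa j = θ j * a j
    entry : ∀ j → lowerBidiag θ t j * a j ≈ θa j * δ (toℕ t) (toℕ j) + a j * δ (toℕ t) (suc (toℕ j))
    entry j = trans (*-congʳ (lowerBidiag-δ t j))
      (trans (distribʳ (a j) _ _) (+-cong (xy∙z≈xz∙y _ _ _) (*-comm _ (a j))))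

  lowerBidiag-column : ∀ (α : ℕ → Carrier) → α n ≈ 0# → ∀ j →
    sumF (λ t → α (toℕ t) * lowerBidiag θ t j) ≈ α (toℕ j) * θ j + α (suc (toℕ j))
  lowerBidiag-column α αn≈0 j = begin
    sumF (λ t → α (toℕ t) * lowerBidiag θ t j)
      ≈⟨ sumF-cong entry ⟩
    sumF (λ t → αθ t * δ (toℕ t) (toℕ j) + α̂ t * δ (toℕ t) (suc (toℕ j)))
      ≈⟨ sumF-distrib-+ (λ t → αθ t * δ (toℕ t) (toℕ j)) (λ t → α̂ t * δ (toℕ t) (suc (toℕ j))) ⟩
    sumF (λ t → αθ t * δ (toℕ t) (toℕ j)) + sumF (λ t → α̂ t * δ (toℕ t) (suc (toℕ j)))
      ≈⟨ +-cong (sumF-δ αθ (toℕ j)) (sumF-δ α̂ (suc (toℕ j))) ⟩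
    at αθ (toℕ j) + at α̂ (suc (toℕ j))
      ≈⟨ +-cong (reflexive (at-toℕ αθ j)) next ⟩
    α (toℕ j) * θ j + α (suc (toℕ j)) ∎
    where
    α̂ αθ : Fin n → Carrier
    α̂ t = α (toℕ t)
    αθ t = α̂ t * θ j
    entry : ∀ t → α̂ t * lowerBidiag θ t j ≈ αθ t * δ (toℕ t) (toℕ j) + α̂ t * δ (toℕ t) (suc (toℕ j))
    entry t = trans (*-congˡ (lowerBidiag-δ t j)) (trans (distribˡ _ _ _) (+-congʳ (sym (*-assoc _ _ _))))
    next : at α̂ (suc (toℕ j)) ≈ α (suc (toℕ j))
    next with suc (toℕ j) ℕ.<? n
    ... | yes 1+j<n = reflexive (at-∘toℕ α 1+j<n)
    ... | no 1+j≮n rewrite ℕ.≤-antisym (Fin.toℕ<n j) (ℕ.≮⇒≥ 1+j≮n) =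
      trans (reflexive (at-≥ α̂ ℕ.≤-refl)) (sym αn≈0)

  -- Column j of L has θ j on the diagonal and 1 just below it, so this recursion is exactly
  -- (ρ m L) j = θ m * ρ m j.
  ρ : Fin n → ℕ → Carrier
  ρ m zero = 1#
  ρ m (suc s) = (θ m - at θ s) * ρ m s

  ρ-vanishes : ∀ m {s} → toℕ m < s → ρ m s ≈ 0#
  ρ-vanishes m {suc s} (s≤s m≤s) with ℕ.m≤n⇒m<n∨m≡n m≤s
  ... | inj₁ m<s = trans (*-congˡ (ρ-vanishes m m<s)) (zeroʳ _)
  ... | inj₂ ≡.refl = trans (*-congʳ (x≈y⇒x∙y⁻¹≈ε (reflexive (≡.sym (at-toℕ θ m))))) (zeroˡ _)

  ρ-leftEigenvector : ∀ m → IsLeftEigenvector (lowerBidiag θ) (θ m) (λ t → ρ m (toℕ t))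
  ρ-leftEigenvector m j = begin
    sumF (λ t → ρ m (toℕ t) * lowerBidiag θ t j)
      ≈⟨ lowerBidiag-column (ρ m) (ρ-vanishes m (Fin.toℕ<n m)) j ⟩
    r * θ j + (θ m - at θ (toℕ j)) * r
      ≡⟨ ≡.cong (λ x → r * θ j + (θ m - x) * r) (at-toℕ θ j) ⟩
    r * θ j + (θ m - θ j) * r
      ≈⟨ +-cong (*-comm r (θ j)) ([y-z]x≈yx-zx r (θ m) (θ j)) ⟩
    θ j * r + (θ m * r - θ j * r)
      ≈⟨ +-assoc _ _ _ ⟨
    θ j * r + θ m * r - θ j * r
      ≈⟨ xyx⁻¹≈y (θ j * r) (θ m * r) ⟩
    θ m * r ∎
    where
    r : Carrier
    r = ρ m (toℕ j)

  ρ-dot-vanishesBelow : ∀ m {a} → VanishesBelow (toℕ m) a →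
    sumF (λ t → ρ m (toℕ t) * a t) ≈ ρ m (toℕ m) * a m
  ρ-dot-vanishesBelow m {a} a<m≈0 = sumF-single (λ t → ρ m (toℕ t) * a t) m other≈0
    where
    other≈0 : ∀ t → ¬ t ≡ m → ρ m (toℕ t) * a t ≈ 0#
    other≈0 t t≢m with ℕ.<-cmp (toℕ t) (toℕ m)
    ... | tri< t<m _ _ =
      trans (*-congˡ (trans (reflexive (≡.sym (at-toℕ a t))) (a<m≈0 (toℕ t) t<m))) (zeroʳ _)
    ... | tri≈ _ t≡m _ = ⊥-elim (t≢m (Fin.toℕ-injective t≡m))
    ... | tri> _ _ m<t = trans (*-congʳ (ρ-vanishes m m<t)) (zeroˡ _)

  module Distinct (θ-distinct : ∀ i j → ¬ i ≡ j → ¬ θ i ≈ θ j) where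
    open FieldProperties F

    -- Row t of L a = θ l a reads (θ t − θ l) a t = − a (t − 1).
    lowerBidiag-eigen-step : ∀ {a l} → lowerBidiag θ ⟨ a ⟩ ≈ᵥ θ l · a →
      ∀ s → shift (at a) s ≈ 0# → ¬ s ≡ toℕ l → at a s ≈ 0#
    lowerBidiag-eigen-step {a} {l} La≈θa s shifted≈0 s≢l with s ℕ.<? n
    ... | no s≮n = reflexive (at-≥ a (ℕ.≮⇒≥ s≮n))
    ... | yes s<n = trans (reflexive (at-fromℕ< a s<n))
      (x≉0⇒x*y≈0⇒y≈0 (x≉y⇒x-y≉0 (θ-distinct t l t≢l)) (begin
        (θ t - θ l) * a t                    ≈⟨ [y-z]x≈yx-zx (a t) (θ t) (θ l) ⟩
        θ t * a t - θ l * a t                ≈⟨ x≈y⇒x∙y⁻¹≈ε θa≈θa ⟩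
        0#                                   ∎))
      where
      t : Fin n
      t = fromℕ< s<n
      toℕt≡s : toℕ t ≡ s
      toℕt≡s = Fin.toℕ-fromℕ< s<n
      t≢l : ¬ t ≡ l
      t≢l t≡l = s≢l (≡.trans (≡.sym toℕt≡s) (≡.cong toℕ t≡l))
      θa≈θa : θ t * a t ≈ θ l * a t
      θa≈θa = begin
        θ t * a t                            ≈⟨ +-identityʳ _ ⟨
        θ t * a t + 0#                       ≈⟨ +-congˡ shifted≈0 ⟨
        θ t * a t + shift (at a) s           ≡⟨ ≡.cong (λ x → θ t * a t + shift (at a) x) toℕt≡s ⟨
        θ t * a t + shift (at a) (toℕ t)     ≈⟨ lowerBidiag-row a t ⟨
        (lowerBidiag θ ⟨ a ⟩) t              ≈⟨ La≈θa t ⟩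
        θ l * a t ∎

    lowerBidiag-eigen-vanishesBelow : ∀ {a l} → lowerBidiag θ ⟨ a ⟩ ≈ᵥ θ l · a → VanishesBelow (toℕ l) a
    lowerBidiag-eigen-vanishesBelow La≈θa zero 0<l = lowerBidiag-eigen-step La≈θa zero refl (ℕ.<⇒≢ 0<l)
    lowerBidiag-eigen-vanishesBelow La≈θa (suc s) 1+s<l = lowerBidiag-eigen-step La≈θa (suc s)
      (lowerBidiag-eigen-vanishesBelow La≈θa s (ℕ.<-trans (ℕ.n<1+n s) 1+s<l)) (ℕ.<⇒≢ 1+s<l)

    lowerBidiag-eigen-≈0 : ∀ {a l} → lowerBidiag θ ⟨ a ⟩ ≈ᵥ θ l · a → a l ≈ 0# → a ≈ᵥ 0ᵥ
    lowerBidiag-eigen-≈0 {a} {l} La≈θa al≈0 t = trans (reflexive (≡.sym (at-toℕ a t))) (at≈0 (toℕ t))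
      where
      at≈0 : ∀ s → at a s ≈ 0#
      at≈0 s with s ℕ.≟ toℕ l
      ... | yes ≡.refl = trans (reflexive (at-toℕ a l)) al≈0
      at≈0 zero | no s≢l = lowerBidiag-eigen-step La≈θa zero refl s≢l
      at≈0 (suc s) | no s≢l = lowerBidiag-eigen-step La≈θa (suc s) (at≈0 s) s≢l

    ρ-nonzero : ∀ m {s} → s ≤ toℕ m → ¬ ρ m s ≈ 0#
    ρ-nonzero m {zero} _ = 1≉0
    ρ-nonzero m {suc s} s<m = x≉0∧y≉0⇒x*y≉0 (x≉y⇒x-y≉0 θm≉θs) (ρ-nonzero m (ℕ.<⇒≤ s<m))
      where
      s<n : s < n
      s<n = ℕ.<-≤-trans s<m (ℕ.<⇒≤ (Fin.toℕ<n m))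
      θm≉θs : ¬ θ m ≈ at θ s
      θm≉θs θm≈θs = θ-distinct m (fromℕ< s<n)
        (λ m≡s → ℕ.<⇒≢ s<m (≡.trans (≡.sym (Fin.toℕ-fromℕ< s<n)) (≡.cong toℕ (≡.sym m≡s))))
        (trans θm≈θs (reflexive (at-fromℕ< θ s<n)))

module UpperBidiagonal {c ℓ} (F : Field c ℓ) {d} (θs : Fin (suc d) → LinAlg.Carrier F)
  (φ : Fin d → LinAlg.Carrier F) where
  open Field F hiding (Carrier; 0#; _≈_; zero)
  open LinAlg F
  open Summation F
  open FinSequences F
  open import Algebra.Properties.CommutativeSemigroup *-commutativeSemigroup
    using (xy∙z≈x∙zy; xy∙z≈xz∙y)
  open import Relation.Binary.Reasoning.Setoid setoid

  U : Mat (suc d)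
  U = upperBidiag θs φ

  upperBidiag-δ : ∀ i j → U i j ≈ θs i * δ (toℕ i) (toℕ j) + at φ (toℕ i) * δ (toℕ j) (suc (toℕ i))
  upperBidiag-δ i j with toℕ i ℕ.≟ toℕ j
  ... | yes i≡j rewrite i≡j | δ-refl (toℕ j) | δ-≢ {toℕ j} {suc (toℕ j)} (≡.≢-sym ℕ.1+n≢n) =
    sym (trans (+-congˡ (zeroʳ _)) (trans (+-identityʳ _) (*-identityʳ _)))
  ... | no i≢j with toℕ j ℕ.≟ suc (toℕ i)
  ...   | yes j≡1+i rewrite δ-≢ i≢j | j≡1+i | δ-refl (suc (toℕ i)) =
    sym (trans (+-congʳ (zeroʳ _)) (trans (+-identityˡ _) (*-identityʳ _)))
  ...   | no j≢1+i rewrite δ-≢ i≢j | δ-≢ j≢1+i =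
    sym (trans (+-congʳ (zeroʳ _)) (trans (+-identityˡ _) (zeroʳ _)))

  upperBidiag-row : ∀ (a : Vec (suc d)) t → (U ⟨ a ⟩) t ≈ θs t * a t + at φ (toℕ t) * at a (suc (toℕ t))
  upperBidiag-row a t = begin
    sumF (λ j → U t j * a j)
      ≈⟨ sumF-cong entry ⟩
    sumF (λ j → θs t * diagonal j + φt * superdiagonal j)
      ≈⟨ sumF-distrib-+ (λ j → θs t * diagonal j) (λ j → φt * superdiagonal j) ⟩
    sumF (λ j → θs t * diagonal j) + sumF (λ j → φt * superdiagonal j)
      ≈⟨ +-cong (*-distribˡ-sumF (θs t) diagonal) (*-distribˡ-sumF φt superdiagonal) ⟨
    θs t * sumF diagonal + φt * sumF superdiagonal
      ≈⟨ +-cong (*-congˡ (sumF-δ a (toℕ t))) (*-congˡ (sumF-δ a (suc (toℕ t)))) ⟩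
    θs t * at a (toℕ t) + φt * at a (suc (toℕ t))
      ≡⟨ ≡.cong (λ x → θs t * x + φt * at a (suc (toℕ t))) (at-toℕ a t) ⟩
    θs t * a t + φt * at a (suc (toℕ t)) ∎
    where
    φt : Carrier
    φt = at φ (toℕ t)
    diagonal superdiagonal : Fin (suc d) → Carrier
    diagonal j = a j * δ (toℕ j) (toℕ t)
    superdiagonal j = a j * δ (toℕ j) (suc (toℕ t))
    entry : ∀ j → U t j * a j ≈ θs t * diagonal j + φt * superdiagonal j
    entry j = trans (*-congʳ (upperBidiag-δ t j)) (trans (distribʳ (a j) _ _)
      (+-cong (trans (xy∙z≈x∙zy _ _ _) (*-congˡ (*-congˡ (reflexive (δ-sym (toℕ t) (toℕ j))))))
              (xy∙z≈x∙zy _ _ _)))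

  upperBidiag-vanishesBelow : ∀ {m a} → VanishesBelow (suc m) a → VanishesBelow m (U ⟨ a ⟩)
  upperBidiag-vanishesBelow {m} {a} a≈0 s s<m with s ℕ.<? suc d
  ... | no s≮n = reflexive (at-≥ (U ⟨ a ⟩) (ℕ.≮⇒≥ s≮n))
  ... | yes s<n = begin
    at (U ⟨ a ⟩) s                                    ≡⟨ at-fromℕ< (U ⟨ a ⟩) s<n ⟩
    (U ⟨ a ⟩) t                                       ≈⟨ upperBidiag-row a t ⟩
    θs t * a t + at φ (toℕ t) * at a (suc (toℕ t))    ≈⟨ +-cong (*-congˡ at≈0) (*-congˡ next≈0) ⟩
    θs t * 0# + at φ (toℕ t) * 0#                     ≈⟨ +-cong (zeroʳ _) (zeroʳ _) ⟩
    0# + 0#                                           ≈⟨ +-identityʳ 0# ⟩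
    0# ∎
    where
    t : Fin (suc d)
    t = fromℕ< s<n
    toℕt≡s : toℕ t ≡ s
    toℕt≡s = Fin.toℕ-fromℕ< s<n
    at≈0 : a t ≈ 0#
    at≈0 = trans (reflexive (≡.sym (at-fromℕ< a s<n))) (a≈0 s (ℕ.m<n⇒m<1+n s<m))
    next≈0 : at a (suc (toℕ t)) ≈ 0#
    next≈0 = ≡.subst (λ x → at a (suc x) ≈ 0#) (≡.sym toℕt≡s) (a≈0 (suc s) (s≤s s<m))

  upperBidiag-inject₁ : ∀ k {a} → VanishesBelow (suc (toℕ k)) a →
    (U ⟨ a ⟩) (inject₁ k) ≈ φ k * a (Fin.suc k)
  upperBidiag-inject₁ k {a} a≈0 = begin
    (U ⟨ a ⟩) (inject₁ k)
      ≈⟨ upperBidiag-row a (inject₁ k) ⟩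
    θs (inject₁ k) * a (inject₁ k) + at φ (toℕ (inject₁ k)) * at a (suc (toℕ (inject₁ k)))
      ≡⟨ ≡.cong₂ (λ x y → θs (inject₁ k) * a (inject₁ k) + x * y) (at-toℕ-inject₁ φ k) a-entry ⟩
    θs (inject₁ k) * a (inject₁ k) + φ k * a (Fin.suc k)
      ≈⟨ +-congʳ (trans (*-congˡ a≈0′) (zeroʳ _)) ⟩
    0# + φ k * a (Fin.suc k)
      ≈⟨ +-identityˡ _ ⟩
    φ k * a (Fin.suc k) ∎
    where
    a-entry : at a (suc (toℕ (inject₁ k))) ≡ a (Fin.suc k)
    a-entry = ≡.trans (≡.cong (λ x → at a (suc x)) (Fin.toℕ-inject₁ k)) (at-toℕ a (Fin.suc k))
    a≈0′ : a (inject₁ k) ≈ 0#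
    a≈0′ = trans (reflexive (≡.sym (at-toℕ a (inject₁ k))))
      (a≈0 (toℕ (inject₁ k)) (s≤s (ℕ.≤-reflexive (Fin.toℕ-inject₁ k))))

  upperBidiag-column-suc : ∀ k (w : Vec (suc d)) →
    sumF (λ t → U t (Fin.suc k) * w t) ≈ θs (Fin.suc k) * w (Fin.suc k) + φ k * w (inject₁ k)
  upperBidiag-column-suc k w = begin
    sumF (λ t → U t i * w t)
      ≈⟨ sumF-cong entry ⟩
    sumF (λ t → θw t * δ (toℕ t) (toℕ i) + φw t * δ (toℕ k) (toℕ t))
      ≈⟨ sumF-distrib-+ (λ t → θw t * δ (toℕ t) (toℕ i)) (λ t → φw t * δ (toℕ k) (toℕ t)) ⟩
    sumF (λ t → θw t * δ (toℕ t) (toℕ i)) + sumF (λ t → φw t * δ (toℕ k) (toℕ t))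
      ≈⟨ +-cong (sumF-δ θw (toℕ i)) (sumF-δ′ φw (toℕ k)) ⟩
    at θw (toℕ i) + at φw (toℕ k)
      ≡⟨ ≡.cong₂ _+_ (at-toℕ θw i) (at-inject₁ φw k) ⟩
    θs i * w i + at φ (toℕ (inject₁ k)) * w (inject₁ k)
      ≡⟨ ≡.cong (λ x → θs i * w i + x * w (inject₁ k)) (at-toℕ-inject₁ φ k) ⟩
    θs i * w i + φ k * w (inject₁ k) ∎
    where
    i : Fin (suc d)
    i = Fin.suc k
    θw φw : Fin (suc d) → Carrier
    θw t = θs t * w t
    φw t = at φ (toℕ t) * w t
    entry : ∀ t → U t i * w t ≈ θw t * δ (toℕ t) (toℕ i) + φw t * δ (toℕ k) (toℕ t)
    entry t = trans (*-congʳ (upperBidiag-δ t i))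
      (trans (distribʳ (w t) _ _) (+-cong (xy∙z≈xz∙y _ _ _) (xy∙z≈xz∙y _ _ _)))

module BidiagonalPair {c ℓ} (F : Field c ℓ) {d}
  (A : LinAlg.Mat F (suc d)) (E : Fin (suc d) → LinAlg.Mat F (suc d)) (As : LinAlg.Mat F (suc d))
  (θ θs : Fin (suc d) → Field.Carrier F) (φ : Fin d → Field.Carrier F)
  (u : Fin (suc d) → LinAlg.Vec F (suc d))
  (θ-distinct : ∀ i j → ¬ i ≡ j → ¬ Field._≈_ F (θ i) (θ j))
  (E-primitive : ∀ i → LinAlg.IsPrimitiveIdempotent F A θ i (E i))
  (basis : LinAlg.IsBasis F u)
  (A-lower : LinAlg.Represents F u A (LinAlg.lowerBidiag F θ))
  (As-upper : LinAlg.Represents F u As (LinAlg.upperBidiag F θs φ)) where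

  open Field F hiding (Carrier; 0#; _≈_; zero)
  open LinAlg F
  open Summation F
  open FieldProperties F
  open FinSequences F using (VanishesBelow)
  open MatrixAction F
  open Coordinates F u basis
  open LowerBidiagonal F θ
  open LowerBidiagonal.Distinct F θ θ-distinct
  open UpperBidiagonal F θs φ
  open import Algebra.Properties.Ring ring using (xyx⁻¹≈y)
  open import Relation.Binary.Reasoning.Setoid setoid

  ρ̂ : Fin (suc d) → Fin (suc d) → Carrier
  ρ̂ m t = ρ m (toℕ t)

  ψ : Fin (suc d) → Vec (suc d) → Carrier
  ψ m = form (ρ̂ m)

  E-eigenvector : ∀ m v → lowerBidiag θ ⟨ coef (E m ⟨ v ⟩) ⟩ ≈ᵥ θ m · coef (E m ⟨ v ⟩)
  E-eigenvector m v = coef-eigenvector {A} {lowerBidiag θ} A-lower (proj₁ (E-primitive m v))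

  ψ-E : ∀ m v → ψ m (E m ⟨ v ⟩) ≈ ψ m v
  ψ-E m = form-primitiveIdempotent (ρ̂ m) {A} {lowerBidiag θ} {θ} {m} {E m}
    A-lower (ρ-leftEigenvector m) (λ j j≢m → θ-distinct j m j≢m) (E-primitive m)

  ψ-E-leading : ∀ m v → ψ m (E m ⟨ v ⟩) ≈ ρ m (toℕ m) * coef (E m ⟨ v ⟩) m
  ψ-E-leading m v = ρ-dot-vanishesBelow m (lowerBidiag-eigen-vanishesBelow (E-eigenvector m v))

  coef-E-basis : ∀ m → coef (E m ⟨ u m ⟩) m ≈ 1#
  coef-E-basis m = *-cancelˡ-≉0 (ρ-nonzero m ℕ.≤-refl) (begin
    ρ m (toℕ m) * coef (E m ⟨ u m ⟩) m   ≈⟨ ψ-E-leading m (u m) ⟨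
    ψ m (E m ⟨ u m ⟩)                    ≈⟨ ψ-E m (u m) ⟩
    ψ m (u m)                            ≈⟨ form-basis (ρ̂ m) m ⟩
    ρ m (toℕ m)                          ≈⟨ *-identityʳ _ ⟨
    ρ m (toℕ m) * 1# ∎)

  module _ (k : Fin d) where

    i i′ : Fin (suc d)
    i = Fin.suc k
    i′ = inject₁ k

    coef-E-As-E : ∀ v → coef (E i′ ⟨ As ⟨ E i ⟨ v ⟩ ⟩ ⟩) i′ ≈ φ k * coef (E i ⟨ v ⟩) i
    coef-E-As-E v = *-cancelˡ-≉0 (ρ-nonzero i′ ℕ.≤-refl) (begin
      ρ i′ (toℕ i′) * coef (E i′ ⟨ As ⟨ x ⟩ ⟩) i′   ≈⟨ ψ-E-leading i′ (As ⟨ x ⟩) ⟨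
      ψ i′ (E i′ ⟨ As ⟨ x ⟩ ⟩)                      ≈⟨ ψ-E i′ (As ⟨ x ⟩) ⟩
      ψ i′ (As ⟨ x ⟩)                               ≈⟨ form-represents (ρ̂ i′) {As} {U} As-upper x ⟩
      sumF (λ t → ρ i′ (toℕ t) * (U ⟨ coef x ⟩) t)  ≈⟨ ρ-dot-vanishesBelow i′ Ux-vanishes ⟩
      ρ i′ (toℕ i′) * (U ⟨ coef x ⟩) i′             ≈⟨ *-congˡ (upperBidiag-inject₁ k x-vanishes) ⟩
      ρ i′ (toℕ i′) * (φ k * coef x i) ∎)
      where
      x : Vec (suc d)
      x = E i ⟨ v ⟩
      x-vanishes : VanishesBelow (toℕ i) (coef x)
      x-vanishes = lowerBidiag-eigen-vanishesBelow (E-eigenvector i v)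
      Ux-vanishes : VanishesBelow (toℕ i′) (U ⟨ coef x ⟩)
      Ux-vanishes = ≡.subst (λ m → VanishesBelow m (U ⟨ coef x ⟩)) (≡.sym (Fin.toℕ-inject₁ k))
        (upperBidiag-vanishesBelow x-vanishes)

    E-As-E≈0⇔φ≈0 : ((E i′ ∘ₘ As) ∘ₘ E i ≈ₘ 0ₘ) ⇔ (φ k ≈ 0#)
    E-As-E≈0⇔φ≈0 = mk⇔ φ≈0 E-As-E≈0
      where
      φ≈0 : (E i′ ∘ₘ As) ∘ₘ E i ≈ₘ 0ₘ → φ k ≈ 0#
      φ≈0 M≈0 = begin
        φ k                                         ≈⟨ *-identityʳ (φ k) ⟨
        φ k * 1#                                    ≈⟨ *-congˡ (coef-E-basis i) ⟨
        φ k * coef (E i ⟨ u i ⟩) i                  ≈⟨ coef-E-As-E (u i) ⟨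
        coef (E i′ ⟨ As ⟨ E i ⟨ u i ⟩ ⟩ ⟩) i′       ≈⟨ coef-zero z≈0 i′ ⟩
        0# ∎
        where
        z≈0 : E i′ ⟨ As ⟨ E i ⟨ u i ⟩ ⟩ ⟩ ≈ᵥ 0ᵥ
        z≈0 p = trans (sym (∘ₘ-∘ₘ-⟨⟩ (E i′) As (E i) (u i) p))
          (Equivalence.to (≈0ₘ⇔⟨⟩≈0ᵥ _) M≈0 (u i) p)
      E-As-E≈0 : φ k ≈ 0# → (E i′ ∘ₘ As) ∘ₘ E i ≈ₘ 0ₘ
      E-As-E≈0 φ≈0 = Equivalence.from (≈0ₘ⇔⟨⟩≈0ᵥ _) (λ v p →
        trans (∘ₘ-∘ₘ-⟨⟩ (E i′) As (E i) v p) (coef≈0⇒≈0ᵥ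
          (lowerBidiag-eigen-≈0 (E-eigenvector i′ (As ⟨ E i ⟨ v ⟩ ⟩))
            (trans (coef-E-As-E v) (trans (*-congʳ φ≈0) (zeroˡ _)))) p))

    As-θsI-basis : (As -ₘ θs i I) ⟨ u i ⟩ ≈ᵥ φ k · u i′
    As-θsI-basis p = begin
      ((As -ₘ θs i I) ⟨ u i ⟩) p                          ≈⟨ -ₘI-⟨⟩ As (θs i) (u i) p ⟩
      (As ⟨ u i ⟩) p - θs i * u i p                       ≈⟨ +-congʳ (As-upper i p) ⟩
      sumF (λ t → U t i * u t p) - θs i * u i p           ≈⟨ +-congʳ (upperBidiag-column-suc k (λ t → u t p)) ⟩
      θs i * u i p + φ k * u i′ p - θs i * u i p          ≈⟨ xyx⁻¹≈y (θs i * u i p) (φ k * u i′ p) ⟩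
      φ k * u i′ p ∎

    image⇔φ≉0 : SameSubset (Image (As -ₘ θs i I) (Span1 (u i))) (Span1 (u i′)) ⇔ (¬ φ k ≈ 0#)
    image⇔φ≉0 = image-Span1⇔ (As -ₘ θs i I) As-θsI-basis (basis-≉0 i′)

lemma7p7 : ∀ {c ℓ} (F : Field c ℓ) (d : ℕ) → let open LinAlg F in
    (A : Mat (suc d)) (E : Fin (suc d) → Mat (suc d))
    (As : Mat (suc d)) (Es : Fin (suc d) → Mat (suc d))
    (θ θs : Fin (suc d) → Carrier) →
    IsPreLeonardSystem A E As Es θ θs →
    (φ : Fin d → Carrier) (u : Fin (suc d) → Vec (suc d)) →
    IsBasis u →
    Represents u A (lowerBidiag θ) →
    Represents u As (upperBidiag θs φ) →
    -- i = suc k ranges over 1..d, i-1 = inject₁ k, φ_i = φ k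
    (k : Fin d) →
      ((¬ (((E (inject₁ k)) ∘ₘ As) ∘ₘ E (Fin.suc k) ≈ₘ 0ₘ))
        ⇔ SameSubset (Image (As -ₘ θs (Fin.suc k) I) (Span1 (u (Fin.suc k))))
                     (Span1 (u (inject₁ k))))
    × ((¬ (((E (inject₁ k)) ∘ₘ As) ∘ₘ E (Fin.suc k) ≈ₘ 0ₘ))
        ⇔ (¬ (φ k ≈ 0#)))
lemma7p7 F d A E As Es θ θs ((θ-distinct , _) , E-primitive , _) φ u basis A-lower As-upper k =
  ⇔-sym (image⇔φ≉0 k) ⇔-∘ ¬-cong-⇔ (E-As-E≈0⇔φ≈0 k) , ¬-cong-⇔ (E-As-E≈0⇔φ≈0 k)
  where open BidiagonalPair F A E As θ θs φ u θ-distinct E-primitive basis A-lower As-upper
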